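{- For every tree poset $P$, every element $x\in P$, every positive integer $t$, and every set system $\mathcal{S}\subseteq 2^{[n]}$, there is a collection $\mathcal{C}$ of pairs $(\mathcal{H},\mathcal{G})$ with $\mathcal{H},\mathcal{G}\subseteq\mathcal{S}$ such that: (i) for each $P$-free set system $\mathcal{F}\subseteq\mathcal{S}$ there is a pair $(\mathcal{H},\mathcal{G})\in\mathcal{C}$ with $\mathcal{H}\subseteq\mathcal{F}\subseteq\mathcal{H}\cup\mathcal{G}$; (ii) for each $(\mathcal{H},\mathcal{G})\in\mathcal{C}$, $\mathcal{G}$ is $P(x,t)$-free and $|\mathcal{H}|\le |P||\mathcal{S}|/t$; (iii) for each $\mathcal{H}\subseteq\mathcal{S}$ there is at most one $\mathcal{G}\subseteq\mathcal{S}$ with $(\mathcal{H},\mathcal{G})\in\mathcal{C}$.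
   Context: All posets are finite; set systems are ordered by inclusion. A poset $Q$ contains $P$ if there is an injective map $\pi:P\to Q$ with $\pi(A)\le\pi(B)$ whenever $A\le B$; otherwise $Q$ is $P$-free. The Hasse diagram joins $x,y$ when one covers the other; a tree poset has a tree as Hasse diagram. Blowup: for a tree poset $P$ with $|P|=m$, $x\in P$ and a positive integer $t$, order $P$ as $x=x_1,\dots,x_m$ so that for each $i\ge2$ the Hasse diagram induced on $\{x_1,\dots,x_i\}$ is a tree in which $x_i$ has degree 1. Let $d(x_i)$ be the Hasse-diagram distance from $x$ to $x_i$. Replace $x_i$ by $t^{d(x_i)}$ copies $x_{i,1},\dots,x_{i,t^{d(x_i)}}$. For $i>1$ let $j<i$ be the unique index with $x_ix_j$ an edge and $d(x_i)=d(x_j)+1$; split the copies of $x_i$ into $V_{i,r}=\{x_{i,(r-1)t+1},\dots,x_{i,rt}\}$, $r\in[t^{d(x_i)-1}]$. If $x_i$ covers $x_j$ set $x_{j,r}<v$ for all $v\in V_{i,r}$, otherwise set $x_{j,r}>v$ for all $v\in V_{i,r}$. $P(x,t)$ is the poset generated by these relations (unique up to isomorphism). -}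

module Defs where

open import Data.Nat using (ℕ; zero; suc; _+_; _*_; _^_; _/_; NonZero)
open import Data.Bool using (Bool; true; false; _∧_; _∨_; not; if_then_else_; T)
open import Data.Fin using (Fin; toℕ)
open import Data.Fin.Properties using () renaming (_≟_ to _≟ᶠ_)
open import Data.Fin.Subset using (Subset; _⊆_)
open import Data.List using (List; []; _∷_; _++_; map; length; filterᵇ; allFin)
open import Data.Bool.ListAction using (any)
open import Data.Vec using ([]; _∷_)
open import Data.Product using (Σ; _×_; _,_; ∃)
open import Data.Empty using (⊥)
open import Relation.Nullary using (¬_)
open import Relation.Nullary.Decidable using (⌊_⌋)
open import Relation.Binary using (Rel; Decidable; IsPartialOrder)
open import Relation.Binary.PropositionalEquality using (_≡_)
open import Relation.Binary.Construct.Closure.ReflexiveTransitive using (Star)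
open import Data.List.Relation.Unary.Unique.Propositional using (Unique)
open import Function.Definitions using (Injective)

record FinPoset : Set₁ where
  field
    size      : ℕ
    _≤ₚ_      : Rel (Fin size) _
    _≤ₚ?_     : Decidable _≤ₚ_
    isPartial : IsPartialOrder _≡_ _≤ₚ_

open FinPoset public

module _ (P : FinPoset) where
  private m = size P

  anyFin : (Fin m → Bool) → Bool
  anyFin f = any f (allFin m)

  ltᵇ : Fin m → Fin m → Bool
  ltᵇ a b = ⌊ _≤ₚ?_ P a b ⌋ ∧ not ⌊ a ≟ᶠ b ⌋

  coversᵇ : Fin m → Fin m → Bool
  coversᵇ a b = ltᵇ a b ∧ not (anyFin (λ z → ltᵇ a z ∧ ltᵇ z b))

  adjᵇ : Fin m → Fin m → Bool
  adjᵇ a b = coversᵇ a b ∨ coversᵇ b a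

  data Walk : Fin m → Fin m → Set where
    [-]  : ∀ {a} → Walk a a
    _∷ʷ_ : ∀ {a b c} → T (adjᵇ a b) → Walk b c → Walk a c

  Chain : List (Fin m) → Set
  Chain []            = Data.Unit.⊤ where import Data.Unit
  Chain (a ∷ [])      = Data.Unit.⊤ where import Data.Unit
  Chain (a ∷ b ∷ vs)  = T (adjᵇ a b) × Chain (b ∷ vs)

  last : Fin m → List (Fin m) → Fin m
  last a []       = a
  last a (b ∷ vs) = last b vs

  IsCycle : List (Fin m) → Set
  IsCycle []                  = ⊥
  IsCycle (_ ∷ [])            = ⊥
  IsCycle (_ ∷ _ ∷ [])        = ⊥
  IsCycle (a ∷ b ∷ c ∷ vs)    =
    Unique (a ∷ b ∷ c ∷ vs) × Chain (a ∷ b ∷ c ∷ vs) × T (adjᵇ (last c vs) a)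

  -- tree poset: Hasse diagram is a tree (nonempty, connected, acyclic)
  IsTreePoset : Set
  IsTreePoset = (Σ (Fin m) λ _ → Data.Unit.⊤) × (∀ a b → Walk a b) × (∀ vs → ¬ IsCycle vs)
    where import Data.Unit

leastUpTo : ℕ → (ℕ → Bool) → ℕ
leastUpTo zero    f = zero
leastUpTo (suc b) f = if f zero then zero else suc (leastUpTo b (λ k → f (suc k)))

module _ (P : FinPoset) (x : Fin (size P)) where
  private m = size P

  within : ℕ → Fin m → Bool
  within zero    y = ⌊ y ≟ᶠ x ⌋
  within (suc k) y = within k y ∨ anyFin P (λ z → within k z ∧ adjᵇ P z y)

  -- d(y): Hasse-diagram distance from x to y (P connected ⇒ ≤ m)
  dist : Fin m → ℕ
  dist y = leastUpTo m (λ k → within k y)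

  -- Element (y , c) is the copy y_{c+1} (0-indexed),
  -- c < t ^ d(y).  For y ≠ x with neighbour z, d(y) = d(z)+1, the copy
  -- (y , c) lies in block V_{y,r} with r-1 = ⌊c/t⌋, attached to (z , ⌊c/t⌋).

  module _ (t : ℕ) .{{_ : NonZero t}} where
    BElem : Set
    BElem = Σ (Fin m) (λ y → Fin (t ^ dist y))

    data BGen : BElem → BElem → Set where
      up   : ∀ {z y c′ c} → T (coversᵇ P z y) → dist y ≡ suc (dist z) →
             toℕ c′ ≡ toℕ c / t → BGen (z , c′) (y , c)
      down : ∀ {z y c′ c} → T (coversᵇ P y z) → dist y ≡ suc (dist z) →
             toℕ c′ ≡ toℕ c / t → BGen (y , c) (z , c′)

    _≤B_ : BElem → BElem → Set
    _≤B_ = Star BGen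

Fam : ℕ → Set
Fam n = Subset n → Bool

allSubsets : (n : ℕ) → List (Subset n)
allSubsets zero    = [] ∷ []
allSubsets (suc n) = map (true ∷_) (allSubsets n) ++ map (false ∷_) (allSubsets n)

card : ∀ {n} → Fam n → ℕ
card {n} F = length (filterᵇ F (allSubsets n))

_⊆ᶠ_ : ∀ {n} → Fam n → Fam n → Set
F ⊆ᶠ G = ∀ A → T (F A) → T (G A)

_≐_ : ∀ {n} → Fam n → Fam n → Set
F ≐ G = ∀ A → F A ≡ G A

_∪ᶠ_ : ∀ {n} → Fam n → Fam n → Fam n
(F ∪ᶠ G) A = F A ∨ G A

Contains : ∀ {n} → Fam n → (X : Set) → Rel X _ → Set
Contains {n} F X R =
  Σ (X → Subset n) λ π →
    (∀ a → T (F (π a))) × Injective _≡_ _≡_ π × (∀ a b → R a b → π a ⊆ π b)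

PFree : ∀ {n} → Fam n → FinPoset → Set
PFree F P = ¬ Contains F (Fin (size P)) (_≤ₚ_ P)

BlowupFree : ∀ {n} → Fam n → (P : FinPoset) → Fin (size P) → (t : ℕ) → .{{_ : NonZero t}} → Set
BlowupFree F P x t = ¬ Contains F (BElem P x t) (_≤B_ P x t)

-- While the remaining family S contains a copy of the blowup P(x,t), walk the tree P outwards
-- from x and give every vertex the first copy lying in F among the t copies attached to the copy
-- given to its parent. Since the Hasse diagram is a tree, every cover relation joins a vertex to
-- its parent, so a walk that never gets stuck would produce a copy of P inside F. As F is
-- P-free, the walk stops: either the copy of x is missing from F and is deleted from S, or some
-- block of t sets attached to a chosen copy misses F; then the block is deleted from S and the at
-- most |P| sets chosen so far are added to H. Thus H grows by at most |P| only when S loses t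
-- sets, giving t|H| ≤ |P||S|, and the family left once no copy of P(x,t) remains is G. All
-- choices depend on F only through sets that end up in H, so running the procedure with H itself
-- in place of F returns (H, G) again: G is determined by H, and C is the set of such fixed points.

module Submission where

open import Defs
open import Data.Bool using (Bool; true; false; T; T?; _∧_; _∨_; not)
open import Data.Bool.Properties using (T-∧; T-∨) renaming (_≟_ to _≟ᵇ_)
open import Data.Bool.ListAction using (any)
open import Data.Empty using (⊥-elim)
open import Data.Fin using (Fin; zero; suc; toℕ; cast; combine; fromℕ<)
open import Data.Fin.Properties using (toℕ-cast; toℕ-combine; toℕ-injective; toℕ<n; toℕ≤pred[n]; injective⇒≤; any?; all?)
  renaming (_≟_ to _≟ᶠ_)
open import Data.Fin.Subset using (Subset; _⊆_)
open import Data.Fin.Subset.Properties using (anySubset?; _⊆?_; ⊆-refl; ⊆-trans)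
open import Data.List using (List; []; _∷_; _∷ʳ_; map; length; allFin; tabulate; mapMaybe; filterᵇ; findᵇ)
open import Data.List.Properties using (mapMaybe-cong; length-mapMaybe; length-tabulate)
open import Data.List.Membership.Propositional using (_∈_; lose)
open import Data.List.Membership.Propositional.Properties using (∈-allFin; ∈-++⁺ˡ; ∈-++⁺ʳ; ∈-map⁺; ∈-map⁻)
open import Data.List.Relation.Binary.Disjoint.Propositional using (Disjoint)
open import Data.List.Relation.Unary.All as All using (All; []; _∷_)
import Data.List.Relation.Unary.All.Properties as All
open import Data.List.Relation.Unary.AllPairs using ([]; _∷_)
open import Data.List.Relation.Unary.Any as Any using (here; there; satisfied)
open import Data.List.Relation.Unary.Any.Properties as Any using (any⁺; any⁻)
open import Data.List.Relation.Unary.Unique.Propositional using (Unique)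
import Data.List.Relation.Unary.Unique.Propositional.Properties as Unique
open import Data.Maybe using (Maybe; just; nothing; _>>=_; _<∣>_; maybe′)
import Data.Maybe as Maybe
open import Data.Maybe.Relation.Unary.All as MaybeAll using (just; nothing)
import Data.Maybe.Relation.Unary.Any as MaybeAny
open import Data.Nat as ℕ using (ℕ; zero; suc; _+_; _*_; _^_; _/_; _≤_; _<_; z≤n; s≤s; NonZero)
open import Data.Nat.Properties
  using (module ≤-Reasoning; *-comm; *-distribˡ-+; *-monoʳ-≤; *-zeroʳ; +-assoc; +-cancelˡ-≡; +-comm; +-identityʳ;
         +-mono-≤; +-monoʳ-≤; +-monoˡ-≤; +-suc; <-cmp; <-irrefl; m<m+n; m^n>0; m≤m+n; m≤n⇒m<n∨m≡n; m≤n⇒m≤1+n;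
         n<1+n; n≤0⇒n≡0; n≤1+n; suc-injective; ≤-<-trans; ≤-antisym; ≤-pred; ≤-refl; ≤-reflexive; ≤-trans; ≮⇒≥)
open import Data.Nat.DivMod using (+-distrib-/-∣ˡ; m*n/n≡m; m<n⇒m/n≡0)
open import Data.Nat.Divisibility using (m∣m*n)
open import Data.Nat.Induction using (<-wellFounded)
open import Data.Product using (Σ; Σ-syntax; ∃; ∃₂; _×_; _,_; proj₁; proj₂; curry; uncurry)
import Data.Product.Properties as Product
open import Data.Sum using (_⊎_; inj₁; inj₂; [_,_]; swap)
open import Data.Unit using (tt)
open import Data.Vec using ([]; _∷_)
open import Data.Vec.Properties using (≡-dec; ∷-injectiveʳ)
open import Function using (_∘_; id; Equivalence)
open import Induction.WellFounded using (Acc; acc)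
open import Relation.Binary using (DecidableEquality; IsPartialOrder; tri<; tri≈; tri>)
open import Relation.Binary.Construct.Closure.ReflexiveTransitive using (Star; ε; _◅_; _◅◅_)
open import Relation.Binary.PropositionalEquality
  using (_≡_; _≢_; refl; sym; trans; cong; cong₂; subst; subst₂; module ≡-Reasoning)
open import Relation.Nullary using (¬_; Dec; yes; no)
open import Relation.Nullary.Decidable using (⌊_⌋; toWitness; fromWitness; _×-dec_; _→-dec_; map′)

open Equivalence using (to; from)

T-not⁺ : ∀ {b} → ¬ T b → T (not b)
T-not⁺ {false} _ = tt
T-not⁺ {true}  h = h tt

T-not⁻ : ∀ {b} → T (not b) → ¬ T b
T-not⁻ {false} _ ()

¬∧not⇒T : ∀ {b c} → T b → ¬ T (b ∧ not c) → T c
¬∧not⇒T {true} {true}  _ _ = tt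
¬∧not⇒T {true} {false} _ h = ⊥-elim (h tt)

module _ {A : Set} where

  count : (A → Bool) → List A → ℕ
  count p xs = length (filterᵇ p xs)

  count-mono : ∀ {p q} → (∀ a → T (p a) → T (q a)) → ∀ xs → count p xs ≤ count q xs
  count-mono p⇒q [] = z≤n
  count-mono {p} {q} p⇒q (a ∷ xs) with p a | q a | p⇒q a
  ... | true  | true  | _ = s≤s (count-mono p⇒q xs)
  ... | true  | false | h = ⊥-elim (h tt)
  ... | false | true  | _ = m≤n⇒m≤1+n (count-mono p⇒q xs)
  ... | false | false | _ = count-mono p⇒q xs

  count-∨ : ∀ p q xs → count (λ a → p a ∨ q a) xs ≤ count p xs + count q xs
  count-∨ p q [] = z≤n
  count-∨ p q (a ∷ xs) with p a | q a
  ... | true  | true  = s≤s (≤-trans (count-∨ p q xs) (+-monoʳ-≤ (count p xs) (n≤1+n _)))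
  ... | true  | false = s≤s (count-∨ p q xs)
  ... | false | true  = ≤-trans (s≤s (count-∨ p q xs)) (≤-reflexive (sym (+-suc _ _)))
  ... | false | false = count-∨ p q xs

  count-strict : ∀ {p q a xs} → (∀ b → T (p b) → T (q b)) → a ∈ xs → T (q a) → ¬ T (p a) →
                 suc (count p xs) ≤ count q xs
  count-strict {p} {q} {xs = b ∷ xs} p⇒q (here refl) qa ¬pa with p b | q b | p⇒q b
  ... | true  | _     | _ = ⊥-elim (¬pa tt)
  ... | false | true  | _ = s≤s (count-mono p⇒q xs)
  ... | false | false | _ = ⊥-elim qa
  count-strict {p} {q} {xs = b ∷ xs} p⇒q (there a∈) qa ¬pa with p b | q b | p⇒q b
  ... | true  | true  | _ = s≤s (count-strict p⇒q a∈ qa ¬pa)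
  ... | true  | false | h = ⊥-elim (h tt)
  ... | false | true  | _ = m≤n⇒m≤1+n (count-strict p⇒q a∈ qa ¬pa)
  ... | false | false | _ = count-strict p⇒q a∈ qa ¬pa

  count-none : ∀ {p xs} → All (λ a → ¬ T (p a)) xs → count p xs ≡ 0
  count-none [] = refl
  count-none {p} {a ∷ _} (¬pa ∷ ¬ps) with p a
  ... | true  = ⊥-elim (¬pa tt)
  ... | false = count-none ¬ps

  unique⇒count-≡≤1 : (_≟_ : DecidableEquality A) → ∀ b {xs} → Unique xs → count (λ a → ⌊ a ≟ b ⌋) xs ≤ 1
  unique⇒count-≡≤1 _≟_ b [] = z≤n
  unique⇒count-≡≤1 _≟_ b {a ∷ xs} (a∉xs ∷ u) with a ≟ b
  ... | yes refl = s≤s (≤-reflexive (count-none (All.map (λ {c} a≢c c≡a → a≢c (sym (toWitness {a? = c ≟ a} c≡a)))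
                                                           a∉xs)))
  ... | no _ = unique⇒count-≡≤1 _≟_ b u

  findᵇ-just : ∀ {p : A → Bool} {a} xs → findᵇ p xs ≡ just a → T (p a)
  findᵇ-just {p} (b ∷ xs) eq with p b in pb
  findᵇ-just {p} (b ∷ xs) refl | true = subst T (sym pb) tt
  ... | false = findᵇ-just xs eq

  findᵇ-nothing : ∀ {p : A → Bool} {a xs} → findᵇ p xs ≡ nothing → a ∈ xs → ¬ T (p a)
  findᵇ-nothing {p} {xs = b ∷ xs} eq a∈ with p b in pb
  findᵇ-nothing {p} {xs = b ∷ xs} () a∈ | true
  findᵇ-nothing {p} {xs = b ∷ xs} eq (here refl) | false = λ pa → subst T pb pa
  findᵇ-nothing {p} {xs = b ∷ xs} eq (there a∈) | false = findᵇ-nothing eq a∈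

  findᵇ-agree : ∀ {p q : A → Bool} xs → (∀ a → T (q a) → T (p a)) →
                (∀ a → findᵇ p xs ≡ just a → T (q a)) → findᵇ q xs ≡ findᵇ p xs
  findᵇ-agree [] q⇒p found⇒q = refl
  findᵇ-agree {p} {q} (b ∷ xs) q⇒p found⇒q with p b in pb | q b in qb | found⇒q
  ... | true  | true  | _ = refl
  ... | true  | false | h = ⊥-elim (subst T qb (h b refl))
  ... | false | true  | _ = ⊥-elim (subst T pb (q⇒p b (subst T (sym qb) tt)))
  ... | false | false | h = findᵇ-agree xs q⇒p h

module _ {A B : Set} where

  firstJust : (A → Maybe B) → List A → Maybe B
  firstJust f []       = nothing
  firstJust f (a ∷ as) = f a <∣> firstJust f as

  firstJust-just : ∀ {f : A → Maybe B} xs {b} → firstJust f xs ≡ just b → ∃ λ a → f a ≡ just b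
  firstJust-just {f} (a ∷ as) eq with f a in fa
  ... | just _  = a , trans fa eq
  ... | nothing = firstJust-just as eq

  firstJust-nothing : ∀ {f : A → Maybe B} {xs a} → firstJust f xs ≡ nothing → a ∈ xs → f a ≡ nothing
  firstJust-nothing {f} {a ∷ as} eq a∈ with f a in fa
  firstJust-nothing {f} {a ∷ as} () a∈ | just _
  firstJust-nothing {f} {a ∷ as} eq (here refl) | nothing = fa
  firstJust-nothing {f} {a ∷ as} eq (there a∈) | nothing = firstJust-nothing eq a∈

  firstJust-cong : ∀ {f g : A → Maybe B} → (∀ a → f a ≡ g a) → ∀ xs → firstJust f xs ≡ firstJust g xs
  firstJust-cong f≗g []       = refl
  firstJust-cong f≗g (a ∷ as) = cong₂ _<∣>_ (f≗g a) (firstJust-cong f≗g as)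

allSubsets-complete : ∀ {n} (A : Subset n) → A ∈ allSubsets n
allSubsets-complete []          = here refl
allSubsets-complete (true ∷ A)  = ∈-++⁺ˡ (∈-map⁺ (true ∷_) (allSubsets-complete A))
allSubsets-complete (false ∷ A) = ∈-++⁺ʳ _ (∈-map⁺ (false ∷_) (allSubsets-complete A))

allSubsets-unique : ∀ n → Unique (allSubsets n)
allSubsets-unique zero    = [] ∷ []
allSubsets-unique (suc n) = Unique.++⁺ (Unique.map⁺ ∷-injectiveʳ (allSubsets-unique n))
                                       (Unique.map⁺ ∷-injectiveʳ (allSubsets-unique n)) disjoint
  where
  disjoint : Disjoint (map (true ∷_) (allSubsets n)) (map (false ∷_) (allSubsets n))
  disjoint (p , q) with ∈-map⁻ (true ∷_) p | ∈-map⁻ (false ∷_) q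
  ... | _ , _ , refl | _ , _ , ()

module _ {n : ℕ} where

  _≟ˢ_ : DecidableEquality (Subset n)
  _≟ˢ_ = ≡-dec _≟ᵇ_

  ∅ : Fam n
  ∅ _ = false

  listFam : List (Subset n) → Fam n
  listFam L A = any (λ B → ⌊ A ≟ˢ B ⌋) L

  _∖_ : Fam n → List (Subset n) → Fam n
  (S ∖ L) A = S A ∧ not (listFam L A)

  ∈⇒listFam : ∀ {A L} → A ∈ L → T (listFam L A)
  ∈⇒listFam {A} A∈L = any⁺ _ (Any.map (λ { refl → fromWitness refl }) A∈L)

  listFam⇒∈ : ∀ {A} L → T (listFam L A) → A ∈ L
  listFam⇒∈ {A} L h = Any.map (λ {B} → toWitness {a? = A ≟ˢ B}) (any⁻ _ L h)

  ∪⁺ˡ : ∀ {F G : Fam n} A → T (F A) → T ((F ∪ᶠ G) A)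
  ∪⁺ˡ A h = from T-∨ (inj₁ h)

  ∪⁺ʳ : ∀ {F G : Fam n} A → T (G A) → T ((F ∪ᶠ G) A)
  ∪⁺ʳ {F} A h = from (T-∨ {F A}) (inj₂ h)

  ∪⁻ : ∀ {F G : Fam n} A → T ((F ∪ᶠ G) A) → T (F A) ⊎ T (G A)
  ∪⁻ {F} A = to (T-∨ {F A})

  ≐⇒⊆ : ∀ {F G : Fam n} → F ≐ G → F ⊆ᶠ G
  ≐⇒⊆ F≐G A = subst T (F≐G A)

  ≡⇒≐ : ∀ {F G : Fam n} → F ≡ G → F ≐ G
  ≡⇒≐ refl _ = refl

  card-mono : ∀ {F G : Fam n} → F ⊆ᶠ G → card F ≤ card G
  card-mono F⊆G = count-mono F⊆G (allSubsets n)

  card-∪ : ∀ (F G : Fam n) → card (F ∪ᶠ G) ≤ card F + card G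
  card-∪ F G = count-∨ F G (allSubsets n)

  card-∅ : card ∅ ≡ 0
  card-∅ = count-none (All.universal (λ _ ()) (allSubsets n))

  card-listFam : ∀ L → card (listFam L) ≤ length L
  card-listFam []      = ≤-reflexive card-∅
  card-listFam (B ∷ L) = ≤-trans (card-∪ (λ A → ⌊ A ≟ˢ B ⌋) (listFam L))
                                 (+-mono-≤ (unique⇒count-≡≤1 _≟ˢ_ B (allSubsets-unique n)) (card-listFam L))

  card-∖ : ∀ {S : Fam n} {L} → Unique L → All (T ∘ S) L → card (S ∖ L) + length L ≤ card S
  card-∖ {S} {[]} [] [] = ≤-trans (≤-reflexive (+-identityʳ _)) (card-mono (λ _ → proj₁ ∘ to T-∧))
  card-∖ {S} {B ∷ L} (B∉L ∷ uL) (SB ∷ SL) = begin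
    card (S ∖ (B ∷ L)) + suc (length L)  ≡⟨ +-suc _ _ ⟩
    suc (card (S ∖ (B ∷ L))) + length L  ≤⟨ +-monoˡ-≤ (length L) drop-B ⟩
    card (S ∖ L) + length L              ≤⟨ card-∖ uL SL ⟩
    card S                               ∎
    where
    open ≤-Reasoning
    shrink : ∀ A → T ((S ∖ (B ∷ L)) A) → T ((S ∖ L) A)
    shrink A h with to (T-∧ {S A}) h
    ... | SA , notIn =
      from (T-∧ {S A}) (SA , T-not⁺ (λ inL → T-not⁻ notIn (from (T-∨ {⌊ A ≟ˢ B ⌋}) (inj₂ inL))))
    drop-B : suc (card (S ∖ (B ∷ L))) ≤ card (S ∖ L)
    drop-B = count-strict shrink (allSubsets-complete B)
      (from (T-∧ {S B}) (SB , T-not⁺ (λ inL → All.lookup B∉L (listFam⇒∈ L inL) refl)))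
      (λ h → T-not⁻ (proj₂ (to (T-∧ {S B}) h))
                    (from (T-∨ {⌊ B ≟ˢ B ⌋}) (inj₁ (fromWitness {a? = B ≟ˢ B} refl))))

Contains-mono : ∀ {n} {F G : Fam n} {X R} → F ⊆ᶠ G → Contains F X R → Contains G X R
Contains-mono F⊆G (π , inF , inj , mono) = π , (λ a → F⊆G _ (inF a)) , inj , mono

-- Hasse diagrams of finite posets

module _ (P : FinPoset) where

  anyFin⁺ : ∀ {f : Fin (size P) → Bool} z → T (f z) → T (anyFin P f)
  anyFin⁺ z fz = any⁺ _ (lose (∈-allFin z) fz)

  anyFin⁻ : ∀ {f : Fin (size P) → Bool} → T (anyFin P f) → ∃ λ z → T (f z)
  anyFin⁻ h = satisfied (any⁻ _ (allFin (size P)) h)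

module Covering (P : FinPoset) where
  open IsPartialOrder (isPartial P) using () renaming (refl to ≼-refl; trans to ≼-trans; antisym to ≼-antisym)

  private
    m = size P
    _≼_ = _≤ₚ_ P
    _≼?_ = _≤ₚ?_ P

  Covers : Fin m → Fin m → Set
  Covers a b = T (coversᵇ P a b)

  ltᵇ⇒ : ∀ {a b} → T (ltᵇ P a b) → a ≼ b × a ≢ b
  ltᵇ⇒ {a} {b} h with to (T-∧ {⌊ a ≼? b ⌋}) h
  ... | a≼b , a≢b = toWitness a≼b , λ a≡b → T-not⁻ a≢b (fromWitness a≡b)

  ⇒ltᵇ : ∀ {a b} → a ≼ b → a ≢ b → T (ltᵇ P a b)
  ⇒ltᵇ {a} {b} a≼b a≢b = from T-∧ (fromWitness {a? = a ≼? b} a≼b , T-not⁺ (a≢b ∘ toWitness {a? = a ≟ᶠ b}))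

  between : ∀ {a b} → a ≼ b → a ≢ b → ¬ Covers a b → ∃ λ z → (a ≼ z × a ≢ z) × (z ≼ b × z ≢ b)
  between {a} {b} a≼b a≢b ¬cov
    with z , lt ← anyFin⁻ P (¬∧not⇒T (⇒ltᵇ a≼b a≢b) ¬cov)
    = z , ltᵇ⇒ (proj₁ (to T-∧ lt)) , ltᵇ⇒ (proj₂ (to (T-∧ {ltᵇ P a z}) lt))

  inInterval : Fin m → Fin m → Fin m → Bool
  inInterval a b w = ⌊ a ≼? w ⌋ ∧ ⌊ w ≼? b ⌋

  inInterval⁺ : ∀ {a b w} → a ≼ w → w ≼ b → T (inInterval a b w)
  inInterval⁺ {a} {b} {w} a≼w w≼b = from T-∧ (fromWitness {a? = a ≼? w} a≼w , fromWitness {a? = w ≼? b} w≼b)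

  inInterval⁻ : ∀ {a b w} → T (inInterval a b w) → a ≼ w × w ≼ b
  inInterval⁻ {a} {b} {w} h with to (T-∧ {⌊ a ≼? w ⌋}) h
  ... | a≼w , w≼b = toWitness a≼w , toWitness w≼b

  interval : Fin m → Fin m → ℕ
  interval a b = count (inInterval a b) (allFin m)

  interval-shrinkʳ : ∀ {a z b} → a ≼ z → z ≼ b → z ≢ b → interval a z < interval a b
  interval-shrinkʳ {a} {z} {b} a≼z z≼b z≢b =
    count-strict {p = inInterval a z} {q = inInterval a b}
      (λ _ h → let a≼w , w≼z = inInterval⁻ h in inInterval⁺ a≼w (≼-trans w≼z z≼b))
      (∈-allFin _) (inInterval⁺ (≼-trans a≼z z≼b) ≼-refl)
      (λ h → z≢b (≼-antisym z≼b (proj₂ (inInterval⁻ h))))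

  interval-shrinkˡ : ∀ {a z b} → a ≼ z → z ≼ b → a ≢ z → interval z b < interval a b
  interval-shrinkˡ {a} {z} {b} a≼z z≼b a≢z =
    count-strict {p = inInterval z b} {q = inInterval a b}
      (λ _ h → let z≼w , w≼b = inInterval⁻ h in inInterval⁺ (≼-trans a≼z z≼w) w≼b)
      (∈-allFin _) (inInterval⁺ ≼-refl (≼-trans a≼z z≼b))
      (λ h → a≢z (≼-antisym a≼z (proj₁ (inInterval⁻ h))))

  ≼⇒covers⋆ : ∀ {a b} → a ≼ b → Star Covers a b
  ≼⇒covers⋆ {a} {b} = go (<-wellFounded (interval a b))
    where
    go : ∀ {a b} → Acc _<_ (interval a b) → a ≼ b → Star Covers a b
    go {a} {b} (acc smaller) a≼b with T? (coversᵇ P a b) | a ≟ᶠ b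
    ... | yes cov  | _        = cov ◅ ε
    ... | no _     | yes refl = ε
    ... | no ¬cov  | no a≢b   with between a≼b a≢b ¬cov
    ... | z , (a≼z , a≢z) , (z≼b , z≢b) =
      go (smaller (interval-shrinkʳ a≼z z≼b z≢b)) a≼z ◅◅
      go (smaller (interval-shrinkˡ a≼z z≼b a≢z)) z≼b

-- Tree posets rooted at x

leastUpTo-holds : ∀ {b k} (f : ℕ → Bool) → k < b → T (f k) → T (f (leastUpTo b f))
leastUpTo-holds {suc b} f k<b fk with f zero in f0
... | true = subst T (sym f0) tt
leastUpTo-holds {suc b} {zero}  f k<b       fk | false = ⊥-elim (subst T f0 fk)
leastUpTo-holds {suc b} {suc k} f (s≤s k<b) fk | false = leastUpTo-holds (f ∘ suc) k<b fk

leastUpTo-least : ∀ {b j} (f : ℕ → Bool) → j < leastUpTo b f → ¬ T (f j)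
leastUpTo-least {suc b} f j<ℓ with f zero in f0
leastUpTo-least {suc b} {zero}  f j<ℓ       | false = subst T f0
leastUpTo-least {suc b} {suc j} f (s≤s j<ℓ) | false = leastUpTo-least {b} (f ∘ suc) j<ℓ

module RootedTree (P : FinPoset) (tree : IsTreePoset P) (x : Fin (size P)) where

  private
    m = size P

  connected : ∀ a b → Walk P a b
  connected = proj₁ (proj₂ tree)

  acyclic : ∀ vs → ¬ IsCycle P vs
  acyclic = proj₂ (proj₂ tree)

  Adj : Fin m → Fin m → Set
  Adj a b = T (adjᵇ P a b)

  adj-sym : ∀ {a b} → Adj a b → Adj b a
  adj-sym {a} {b} h = from T-∨ (swap (to (T-∨ {coversᵇ P a b}) h))

  covers-irrefl : ∀ {a} → ¬ T (coversᵇ P a a)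
  covers-irrefl {a} c =
    T-not⁻ (proj₂ (to (T-∧ {⌊ _≤ₚ?_ P a a ⌋}) (proj₁ (to (T-∧ {ltᵇ P a a}) c))))
           (fromWitness {a? = a ≟ᶠ a} refl)

  adj-irrefl : ∀ {a} → ¬ Adj a a
  adj-irrefl {a} h = [ covers-irrefl , covers-irrefl ] (to (T-∨ {coversᵇ P a a}) h)

  Within : ℕ → Fin m → Set
  Within k y = T (within P x k y)

  within-root : Within 0 x
  within-root = fromWitness {a? = x ≟ᶠ x} refl

  within-zero⁻ : ∀ {y} → Within 0 y → y ≡ x
  within-zero⁻ {y} = toWitness {a? = y ≟ᶠ x}

  within-step : ∀ k {z y} → Within k z → Adj z y → Within (suc k) y
  within-step k {z} {y} wz zy = from (T-∨ {within P x k y}) (inj₂ (anyFin⁺ P z (from T-∧ (wz , zy))))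

  within-suc⁻ : ∀ k {y} → Within (suc k) y → Within k y ⊎ ∃ λ z → Within k z × Adj z y
  within-suc⁻ k {y} h with to (T-∨ {within P x k y}) h
  ... | inj₁ wy = inj₁ wy
  ... | inj₂ some with z , wz∧zy ← anyFin⁻ P some = inj₂ (z , to (T-∧ {within P x k z}) wz∧zy)

  walk⇒within : ∀ {a b} k → Walk P a b → Within k a → ∃ λ j → Within j b
  walk⇒within k [-]        wa = k , wa
  walk⇒within k (ab ∷ʷ w) wa = walk⇒within (suc k) w (within-step k wa ab)

  AtLevel : ℕ → Fin m → Set
  AtLevel k y = Within k y × (∀ j → j < k → ¬ Within j y)

  atLevel-unique : ∀ {i j y} → AtLevel i y → AtLevel j y → i ≡ j
  atLevel-unique {i} {j} (wi , below-i) (wj , below-j) with <-cmp i j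
  ... | tri< i<j _ _ = ⊥-elim (below-j i i<j wi)
  ... | tri≈ _ i≡j _ = i≡j
  ... | tri> _ _ j<i = ⊥-elim (below-i j j<i wj)

  atLevel-pred : ∀ {k y} → AtLevel (suc k) y → ∃ λ z → AtLevel k z × Adj z y
  atLevel-pred {k} (w , below) with within-suc⁻ k w
  ... | inj₁ wy = ⊥-elim (below k ≤-refl wy)
  ... | inj₂ (z , wz , zy) = z , (wz , λ j j<k wj → below (suc j) (s≤s j<k) (within-step j wj zy)) , zy

  atLevel-below : ∀ {k y} → AtLevel k y → ∀ j → j ≤ k → ∃ (AtLevel j)
  atLevel-below {k} {y} lvl j j≤k with m≤n⇒m<n∨m≡n j≤k
  ... | inj₂ refl = y , lvl
  atLevel-below {suc k} lvl j j≤k | inj₁ (s≤s j≤k′) with z , lvl′ , _ ← atLevel-pred lvl =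
    atLevel-below lvl′ j j≤k′

  atLevel<size : ∀ {k y} → AtLevel k y → k < m
  atLevel<size {k} lvl = injective⇒≤ {f = vertexAt} vertexAt-injective
    where
    vertexAt : Fin (suc k) → Fin m
    vertexAt i = proj₁ (atLevel-below lvl (toℕ i) (toℕ≤pred[n] i))
    vertexAt-injective : ∀ {i j} → vertexAt i ≡ vertexAt j → i ≡ j
    vertexAt-injective {i} {j} eq = toℕ-injective (atLevel-unique
      (proj₂ (atLevel-below lvl (toℕ i) (toℕ≤pred[n] i)))
      (subst (AtLevel (toℕ j)) (sym eq) (proj₂ (atLevel-below lvl (toℕ j) (toℕ≤pred[n] j)))))

  leastUpTo-atLevel : ∀ {b k y} → k < b → Within k y → AtLevel (leastUpTo b (λ j → within P x j y)) y
  leastUpTo-atLevel {b} {k} {y} k<b wk = leastUpTo-holds level k<b wk , λ j → leastUpTo-least {b} level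
    where
    level : ℕ → Bool
    level j = within P x j y

  dist-atLevel : ∀ y → AtLevel (dist P x y) y
  dist-atLevel y with k , wk ← walk⇒within 0 (connected x y) within-root =
    leastUpTo-atLevel (atLevel<size first) (proj₁ first)
    where
    first = leastUpTo-atLevel (n<1+n k) wk

  dist-least : ∀ {k y} → Within k y → dist P x y ≤ k
  dist-least {k} {y} wk = ≮⇒≥ (λ k<d → proj₂ (dist-atLevel y) k k<d wk)

  dist-root : dist P x x ≡ 0
  dist-root = n≤0⇒n≡0 (dist-least {0} within-root)

  dist≡0⇒root : ∀ {y} → dist P x y ≡ 0 → y ≡ x
  dist≡0⇒root {y} d≡0 = within-zero⁻ (subst (λ k → Within k y) d≡0 (proj₁ (dist-atLevel y)))

  dist-adj : ∀ {z y} → Adj z y → dist P x y ≤ suc (dist P x z)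
  dist-adj {z} zy = dist-least (within-step (dist P x z) (proj₁ (dist-atLevel z)) zy)

  IsParentOf : Fin m → Fin m → Set
  IsParentOf z y = Adj z y × dist P x y ≡ suc (dist P x z)

  parent-exists : ∀ {y} → y ≢ x → ∃ λ z → IsParentOf z y
  parent-exists {y} y≢x with dist P x y in dy | dist-atLevel y
  ... | zero  | _   = ⊥-elim (y≢x (dist≡0⇒root dy))
  ... | suc k | lvl with z , lvl-z , zy ← atLevel-pred lvl =
    z , zy , cong suc (atLevel-unique lvl-z (dist-atLevel z))

  parent : Fin m → Fin m
  parent y with any? (λ z → T? (adjᵇ P z y) ×-dec (dist P x y ℕ.≟ suc (dist P x z)))
  ... | yes (z , _) = z
  ... | no _        = x

  parent-spec : ∀ {y} → y ≢ x → IsParentOf (parent y) y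
  parent-spec {y} y≢x with any? (λ z → T? (adjᵇ P z y) ×-dec (dist P x y ℕ.≟ suc (dist P x z)))
  ... | yes (_ , is-parent) = is-parent
  ... | no none             = ⊥-elim (none (parent-exists y≢x))

  parent-adj : ∀ {y} → y ≢ x → Adj (parent y) y
  parent-adj = proj₁ ∘ parent-spec

  dist-parent : ∀ {y} → y ≢ x → dist P x y ≡ suc (dist P x (parent y))
  dist-parent = proj₂ ∘ parent-spec

  dist-suc⇒non-root : ∀ {y k} → dist P x y ≡ suc k → y ≢ x
  dist-suc⇒non-root dy refl with () ← trans (sym dy) dist-root

  dist-parent-pred : ∀ {y k} → dist P x y ≡ suc k → dist P x (parent y) ≡ k
  dist-parent-pred dy = suc-injective (trans (sym (dist-parent (dist-suc⇒non-root dy))) dy)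

  last-∷ʳ : ∀ a xs {b} → last P a (xs ∷ʳ b) ≡ b
  last-∷ʳ a []       = refl
  last-∷ʳ a (c ∷ cs) = last-∷ʳ c cs

  chain-∷ʳ : ∀ a xs {b} → Chain P (a ∷ xs) → Adj (last P a xs) b → Chain P (a ∷ xs ∷ʳ b)
  chain-∷ʳ a []       _          ab = ab , tt
  chain-∷ʳ a (c ∷ cs) (ac , ch) ab = ac , chain-∷ʳ c cs ch ab

  cycle : ∀ a rest → 2 ≤ length rest → Unique (a ∷ rest) → Chain P (a ∷ rest) → Adj (last P a rest) a →
          IsCycle P (a ∷ rest)
  cycle a (b ∷ c ∷ vs) _           u ch closing = u , ch , closing
  cycle a (b ∷ [])     (s≤s ()) _ _  _

  higher-∉ : ∀ {L w xs} → All (λ z → dist P x z ≤ L) xs → L < dist P x w → All (w ≢_) xs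
  higher-∉ low L<w =
    All.map (λ z≤L w≡z → <-irrefl refl (≤-<-trans (subst (λ v → dist P x v ≤ _) (sym w≡z) z≤L) L<w)) low

  record Bridge (L : ℕ) (u v : Fin m) : Set where
    field
      rest   : List (Fin m)
      long   : 2 ≤ length rest
      ends   : last P u rest ≡ v
      chain  : Chain P (u ∷ rest)
      unique : Unique (u ∷ rest)
      low    : All (λ z → dist P x z ≤ L) (u ∷ rest)

  -- Climb from u and v in lockstep until the parents meet; the inner vertices lie on lower
  -- levels than u and v, which keeps the path simple.
  bridge : ∀ L {u v} → dist P x u ≡ L → dist P x v ≡ L → u ≢ v → Bridge L u v
  bridge zero du dv u≢v = ⊥-elim (u≢v (trans (dist≡0⇒root du) (sym (dist≡0⇒root dv))))
  bridge (suc L) {u} {v} du dv u≢v with parent u ≟ᶠ parent v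
  ... | yes pu≡pv = record
    { rest   = parent u ∷ v ∷ []
    ; long   = s≤s (s≤s z≤n)
    ; ends   = refl
    ; chain  = adj-sym (parent-adj u≢x) , subst (λ z → Adj z v) (sym pu≡pv) (parent-adj v≢x) , tt
    ; unique = (u≢pu ∷ u≢v ∷ []) ∷ (pu≢v ∷ []) ∷ [] ∷ []
    ; low    = ≤-reflexive du ∷ pu≤ ∷ ≤-reflexive dv ∷ []
    }
    where
    u≢x = dist-suc⇒non-root du
    v≢x = dist-suc⇒non-root dv
    dpu : dist P x (parent u) ≡ L
    dpu = dist-parent-pred du
    pu≤ : dist P x (parent u) ≤ suc L
    pu≤ = ≤-trans (≤-reflexive dpu) (n≤1+n L)
    u≢pu : u ≢ parent u
    u≢pu eq = <-irrefl (cong (dist P x) (sym eq)) (subst (_< dist P x u) (sym dpu) (≤-reflexive (sym du)))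
    pu≢v : parent u ≢ v
    pu≢v eq = <-irrefl (cong (dist P x) eq) (subst (_< dist P x v) (sym dpu) (≤-reflexive (sym dv)))
  ... | no pu≢pv = record
    { rest   = parent u ∷ rest ∷ʳ v
    ; long   = s≤s (∷ʳ-nonempty rest)
    ; ends   = last-∷ʳ (parent u) rest
    ; chain  = adj-sym (parent-adj u≢x) ,
               chain-∷ʳ (parent u) rest chain (subst (λ z → Adj z v) (sym ends) (parent-adj v≢x))
    ; unique = All.++⁺ (higher-∉ low L<u) (u≢v ∷ []) ∷ Unique.++⁺ unique ([] ∷ []) v-new
    ; low    = ≤-reflexive du ∷ All.++⁺ (All.map (λ z≤L → ≤-trans z≤L (n≤1+n L)) low) (≤-reflexive dv ∷ [])
    }
    where
    u≢x = dist-suc⇒non-root du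
    v≢x = dist-suc⇒non-root dv
    open Bridge (bridge L (dist-parent-pred du) (dist-parent-pred dv) pu≢pv)
    L<u : L < dist P x u
    L<u = ≤-reflexive (sym du)
    v-new : Disjoint (parent u ∷ rest) (v ∷ [])
    v-new (z∈ , here refl) = All.lookup (higher-∉ low (≤-reflexive (sym dv))) z∈ refl
    ∷ʳ-nonempty : ∀ xs {b : Fin m} → 1 ≤ length (xs ∷ʳ b)
    ∷ʳ-nonempty []      = s≤s z≤n
    ∷ʳ-nonempty (_ ∷ _) = s≤s z≤n

  same-level-nonadjacent : ∀ {a b} → dist P x a ≡ dist P x b → ¬ Adj a b
  same-level-nonadjacent {a} {b} da≡db ab =
    acyclic (a ∷ rest) (cycle a rest long unique chain (subst (λ z → Adj z a) (sym ends) (adj-sym ab)))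
    where
    a≢b : a ≢ b
    a≢b refl = adj-irrefl ab
    open Bridge (bridge (dist P x a) refl (sym da≡db) a≢b)

  lower-neighbour-is-parent : ∀ {a b} → Adj a b → dist P x a < dist P x b → b ≢ x × parent b ≡ a
  lower-neighbour-is-parent {a} {b} ab a<b = b≢x , pb≡a
    where
    db : dist P x b ≡ suc (dist P x a)
    db = ≤-antisym (dist-adj ab) a<b
    b≢x = dist-suc⇒non-root db
    pb≡a : parent b ≡ a
    pb≡a with parent b ≟ᶠ a
    ... | yes eq = eq
    ... | no pb≢a = ⊥-elim (acyclic (b ∷ a ∷ rest)
            (cycle b (a ∷ rest) (s≤s (≤-trans (n≤1+n 1) long)) (higher-∉ low a<b ∷ unique) (adj-sym ab , chain)
                   (subst (λ z → Adj z b) (sym ends) (parent-adj b≢x))))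
      where
      open Bridge (bridge (dist P x a) refl (dist-parent-pred db) (pb≢a ∘ sym))

  adjacent⇒parent-edge : ∀ {a b} → Adj a b → (b ≢ x × parent b ≡ a) ⊎ (a ≢ x × parent a ≡ b)
  adjacent⇒parent-edge {a} {b} ab with <-cmp (dist P x a) (dist P x b)
  ... | tri< a<b _ _ = inj₁ (lower-neighbour-is-parent ab a<b)
  ... | tri≈ _ a≡b _ = ⊥-elim (same-level-nonadjacent a≡b ab)
  ... | tri> _ _ b<a = inj₂ (lower-neighbour-is-parent (adj-sym ab) b<a)

  parent-induction : (Q : Fin m → Set) → Q x → (∀ {y} → y ≢ x → Q (parent y) → Q y) → ∀ y → Q y
  parent-induction Q root step y = go (dist P x y) y refl
    where
    go : ∀ k y → dist P x y ≡ k → Q y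
    go zero    y dy = subst Q (sym (dist≡0⇒root dy)) root
    go (suc k) y dy = step (dist-suc⇒non-root dy) (go k (parent y) (dist-parent-pred dy))

-- Deciding whether a set system contains P(x,t)

Searchable : (A : Set) → (A → A → Set) → Set₁
Searchable A _≈_ = ∀ {Q : A → Set} → (∀ a → Dec (Q a)) → (∀ {a b} → a ≈ b → Q a → Q b) → Dec (∃ Q)

Subset-searchable : ∀ {n} → Searchable (Subset n) _≡_
Subset-searchable Q? _ = anySubset? Q?

Π-searchable : ∀ {N} {B : Fin N → Set} {R : ∀ i → B i → B i → Set} → (∀ i {b} → R i b b) →
               (∀ i → Searchable (B i) (R i)) → Searchable ((i : Fin N) → B i) (λ f g → ∀ i → R i (f i) (g i))
Π-searchable {ℕ.zero} R-refl search Q? resp with Q? (λ ())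
... | yes q = yes (_ , q)
... | no ¬q = no λ (f , q) → ¬q (resp (λ ()) q)
Π-searchable {ℕ.suc N} {B} {R} R-refl search {Q} Q? resp with search zero with-head? head-resp
  where
  cons : B zero → ((i : Fin N) → B (suc i)) → (i : Fin (ℕ.suc N)) → B i
  cons b g zero    = b
  cons b g (suc i) = g i
  WithHead : B zero → Set
  WithHead b = ∃ λ g → Q (cons b g)
  with-head? : ∀ b → Dec (WithHead b)
  with-head? b = Π-searchable (λ i → R-refl (suc i)) (λ i → search (suc i)) (λ g → Q? (cons b g))
                   (λ g≈g′ → resp λ { zero → R-refl zero ; (suc i) → g≈g′ i })
  head-resp : ∀ {b b′} → R zero b b′ → WithHead b → WithHead b′
  head-resp b≈b′ (g , q) = g , resp (λ { zero → b≈b′ ; (suc i) → R-refl (suc i) }) q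
... | yes (b , g , q) = yes (_ , q)
... | no none =
  no λ (f , q) → none (f zero , (λ i → f (suc i)) , resp (λ { zero → R-refl zero ; (suc i) → R-refl (suc i) }) q)

module Blowup (P : FinPoset) (x : Fin (size P)) (t : ℕ) .{{_ : NonZero t}} where

  private
    m = size P

  Copy : Fin m → Set
  Copy y = Fin (t ^ dist P x y)

  bgen? : ∀ a b → Dec (BGen P x t a b)
  bgen? (z , c′) (y , c)
    with T? (coversᵇ P z y) ×-dec dist P x y ℕ.≟ ℕ.suc (dist P x z) ×-dec toℕ c′ ℕ.≟ toℕ c / t
       | T? (coversᵇ P z y) ×-dec dist P x z ℕ.≟ ℕ.suc (dist P x y) ×-dec toℕ c ℕ.≟ toℕ c′ / t
  ... | yes (cov , d , blk) | _                   = yes (up cov d blk)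
  ... | no _                | yes (cov , d , blk) = yes (down cov d blk)
  ... | no ¬up              | no ¬down            =
    no λ { (up cov d blk) → ¬up (cov , d , blk) ; (down cov d blk) → ¬down (cov , d , blk) }

  ∀-BElem? : {Q : BElem P x t → Set} → (∀ a → Dec (Q a)) → Dec (∀ a → Q a)
  ∀-BElem? Q? = map′ (λ all (y , c) → all y c) (λ all y c → all (y , c)) (all? λ y → all? λ c → Q? (y , c))

  module _ {n : ℕ} (G : Fam n) where

    IsBlowupCopy : (BElem P x t → Subset n) → Set
    IsBlowupCopy π =
      (∀ a → T (G (π a))) × (∀ a b → π a ≡ π b → a ≡ b) × (∀ a b → BGen P x t a b → π a ⊆ π b)

    isBlowupCopy? : ∀ π → Dec (IsBlowupCopy π)
    isBlowupCopy? π = ∀-BElem? (λ a → T? (G (π a)))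
                ×-dec ∀-BElem? (λ a → ∀-BElem? λ b → π a ≟ˢ π b →-dec Product.≡-dec _≟ᶠ_ _≟ᶠ_ a b)
                ×-dec ∀-BElem? (λ a → ∀-BElem? λ b → bgen? a b →-dec π a ⊆? π b)

    star-mono : ∀ {π : BElem P x t → Subset n} → (∀ a b → BGen P x t a b → π a ⊆ π b) →
                ∀ a b → _≤B_ P x t a b → π a ⊆ π b
    star-mono mono a .a ε = ⊆-refl
    star-mono mono a b (_◅_ {j = c} g path) = ⊆-trans (mono a c g) (star-mono mono c b path)

    containsBlowup? : Dec (Contains G (BElem P x t) (_≤B_ P x t))
    containsBlowup?
      with Π-searchable (λ _ _ → refl) (λ _ → Π-searchable (λ _ → refl) (λ _ → Subset-searchable))
                        (isBlowupCopy? ∘ uncurry) resp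
      where
      resp : ∀ {f g : (y : Fin m) → Copy y → Subset n} → (∀ y c → f y c ≡ g y c) →
             IsBlowupCopy (uncurry f) → IsBlowupCopy (uncurry g)
      resp f≈g (inG , inj , mono) =
        (λ (y , c) → subst (T ∘ G) (f≈g y c) (inG (y , c))) ,
        (λ (y , c) (y′ , c′) eq → inj (y , c) (y′ , c′) (trans (f≈g y c) (trans eq (sym (f≈g y′ c′))))) ,
        (λ (y , c) (y′ , c′) g → subst₂ _⊆_ (f≈g y c) (f≈g y′ c′) (mono (y , c) (y′ , c′) g))
    ... | yes (f , inG , inj , mono) = yes (uncurry f , inG , (λ {a} {b} → inj a b) , star-mono mono)
    ... | no none =
      no λ (π , inG , inj , mono) → none (curry π , inG , (λ a b → inj) , λ a b g → mono a b (g ◅ ε))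

-- One step of the container algorithm

[n*q+r]/n≡q : ∀ n .{{_ : NonZero n}} q {r} → r < n → (n * q + r) / n ≡ q
[n*q+r]/n≡q n q {r} r<n = begin
  (n * q + r) / n      ≡⟨ +-distrib-/-∣ˡ r (m∣m*n q) ⟩
  n * q / n + r / n    ≡⟨ cong₂ _+_ (trans (cong (_/ n) (*-comm n q)) (m*n/n≡m q n)) (m<n⇒m/n≡0 r<n) ⟩
  q + 0                ≡⟨ +-identityʳ q ⟩
  q                    ∎
  where open ≡-Reasoning

Move : ℕ → Set
Move n = List (Subset n) × List (Subset n)

record IsMove {n} (m t : ℕ) (O S : Fam n) (removed kept : List (Subset n)) : Set where
  field
    removed-unique : Unique removed
    removed-in     : All (T ∘ S) removed
    removed-out    : All (λ A → ¬ T (O A)) removed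
    removed-some   : 1 ≤ length removed
    kept-in        : All (λ A → T (O A) × T (S A)) kept
    kept-bound     : t * length kept ≤ m * length removed

module Greedy (P : FinPoset) (tree : IsTreePoset P) (x : Fin (size P)) (t : ℕ) .{{_ : NonZero t}}
              {n : ℕ} (π : BElem P x t → Subset n) where

  open RootedTree P tree x
  open Blowup P x t

  private
    m = size P

  Selection : Set
  Selection = (y : Fin m) → Maybe (Copy y)

  -- c lies in the block V_{y,c′+1} of copies attached to the parent copy c′ (indices start at 0).
  inBlock : ∀ {z y} → Copy z → Copy y → Bool
  inBlock c′ c = ⌊ toℕ c′ ℕ.≟ toℕ c / t ⌋

  firstIn : Fam n → (y : Fin m) → (Copy y → Bool) → Maybe (Copy y)
  firstIn O y p = findᵇ (λ c → p c ∧ O (π (y , c))) (allFin _)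

  extend : Fam n → (y : Fin m) → Copy (parent y) → Maybe (Copy y)
  extend O y c′ = firstIn O y (inBlock c′)

  -- The recursion runs on the level k = dist P x y, which drops by one at the parent.
  selectAt : Fam n → ℕ → Selection
  selectAt O zero    y = firstIn O y (λ _ → true)
  selectAt O (suc k) y = selectAt O k (parent y) >>= extend O y

  select : Fam n → Selection
  select O y = selectAt O (dist P x y) y

  select-root : ∀ O → select O x ≡ firstIn O x (λ _ → true)
  select-root O = cong (λ k → selectAt O k x) dist-root

  select-child : ∀ O {y} → y ≢ x → select O y ≡ (select O (parent y) >>= extend O y)
  select-child O {y} y≢x = cong (λ k → selectAt O k y) (dist-parent y≢x)

  firstIn-∈ : ∀ {O y p c} → firstIn O y p ≡ just c → T (O (π (y , c)))
  firstIn-∈ {O} {y} {p} {c} found = proj₂ (to (T-∧ {p c}) (findᵇ-just (allFin _) found))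

  firstIn-satisfies : ∀ {O y p c} → firstIn O y p ≡ just c → T (p c)
  firstIn-satisfies {O} {y} {p} {c} found = proj₁ (to (T-∧ {p c}) (findᵇ-just (allFin _) found))

  firstIn-none : ∀ {O y p} c → firstIn O y p ≡ nothing → T (p c) → ¬ T (O (π (y , c)))
  firstIn-none c none pc Oc = findᵇ-nothing none (∈-allFin c) (from T-∧ (pc , Oc))

  selectAt-∈ : ∀ O k y {c} → selectAt O k y ≡ just c → T (O (π (y , c)))
  selectAt-∈ O zero    y found = firstIn-∈ {O} {y} {λ _ → true} found
  selectAt-∈ O (suc k) y found with selectAt O k (parent y)
  ... | just c′ = firstIn-∈ {O} {y} {inBlock c′} found

  select-∈ : ∀ O y {c} → select O y ≡ just c → T (O (π (y , c)))
  select-∈ O y = selectAt-∈ O (dist P x y) y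

  select-attached : ∀ O {y c c′} → y ≢ x → select O y ≡ just c → select O (parent y) ≡ just c′ →
                    toℕ c′ ≡ toℕ c / t
  select-attached O {y} {c′ = c′} y≢x found found′
    rewrite select-child O y≢x | found′ = toWitness (firstIn-satisfies {O} {y} {inBlock c′} found)

  select-blocked : ∀ O {y c′} → y ≢ x → select O (parent y) ≡ just c′ → select O y ≡ nothing →
                   ∀ c → T (inBlock c′ c) → ¬ T (O (π (y , c)))
  select-blocked O {y} {c′} y≢x found′ none c
    rewrite select-child O y≢x | found′ = firstIn-none {O} {y} {inBlock c′} c none

  select-root-missing : ∀ O → select O x ≡ nothing → ∀ c → ¬ T (O (π (x , c)))
  select-root-missing O none c rewrite select-root O = firstIn-none {O} {x} {λ _ → true} c none _

  select-from-root : ∀ O → select O x ≡ nothing → ∀ y → select O y ≡ nothing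
  select-from-root O none = parent-induction (λ y → select O y ≡ nothing) none
    λ {y} y≢x none′ → trans (select-child O y≢x) (cong (_>>= extend O y) none′)

  module _ {H O : Fam n} (H⊆O : H ⊆ᶠ O)
           (selected⇒H : ∀ y {c} → select O y ≡ just c → T (H (π (y , c)))) where

    firstIn-agree : ∀ y p → (∀ {c} → firstIn O y p ≡ just c → T (H (π (y , c)))) → firstIn H y p ≡ firstIn O y p
    firstIn-agree y p found⇒H = findᵇ-agree (allFin _)
      (λ c h → let pc , Hc = to (T-∧ {p c}) h in from T-∧ (pc , H⊆O _ Hc))
      (λ c found → from T-∧ (firstIn-satisfies {O} {y} {p} found , found⇒H found))

    select-agree : ∀ y → select H y ≡ select O y
    select-agree = parent-induction (λ y → select H y ≡ select O y) at-root at-child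
      where
      open ≡-Reasoning
      at-root : select H x ≡ select O x
      at-root = begin
        select H x                ≡⟨ select-root H ⟩
        firstIn H x (λ _ → true)  ≡⟨ firstIn-agree x _ (λ found → selected⇒H x (trans (select-root O) found)) ⟩
        firstIn O x (λ _ → true)  ≡⟨ select-root O ⟨
        select O x                ∎
      at-child : ∀ {y} → y ≢ x → select H (parent y) ≡ select O (parent y) → select H y ≡ select O y
      at-child {y} y≢x same = begin
        select H y                           ≡⟨ select-child H y≢x ⟩
        (select H (parent y) >>= extend H y) ≡⟨ cong (_>>= extend H y) same ⟩
        (select O (parent y) >>= extend H y) ≡⟨ extend-agree _ refl ⟩
        (select O (parent y) >>= extend O y) ≡⟨ select-child O y≢x ⟨
        select O y                           ∎
        where
        extend-agree : ∀ s → select O (parent y) ≡ s → (s >>= extend H y) ≡ (s >>= extend O y)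
        extend-agree nothing   _  = refl
        extend-agree (just c′) eq = firstIn-agree y (inBlock c′)
          (λ found → selected⇒H y (trans (select-child O y≢x) (trans (cong (_>>= extend O y) eq) found)))

  Blocked : Set
  Blocked = Σ[ y ∈ Fin m ] (y ≢ x × Copy (parent y))

  blockedAt : (y : Fin m) → Maybe (Copy y) → Maybe (Copy (parent y)) → Maybe Blocked
  blockedAt y nothing (just c′) with y ≟ᶠ x
  ... | no y≢x = just (y , y≢x , c′)
  ... | yes _  = nothing
  blockedAt y _ _ = nothing

  firstBlocked : Selection → Maybe Blocked
  firstBlocked s = firstJust (λ y → blockedAt y (s y) (s (parent y))) (allFin m)

  data Outcome : Set where
    rootMissing : Outcome
    blocked     : Blocked → Outcome
    complete    : Outcome

  outcomeOf : Maybe (Copy x) → Maybe Blocked → Outcome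
  outcomeOf nothing  _        = rootMissing
  outcomeOf (just _) (just β) = blocked β
  outcomeOf (just _) nothing  = complete

  outcome : Selection → Outcome
  outcome s = outcomeOf (s x) (firstBlocked s)

  outcome-cong : ∀ {s s′ : Selection} → (∀ y → s y ≡ s′ y) → outcome s ≡ outcome s′
  outcome-cong s≗s′ = cong₂ outcomeOf (s≗s′ x)
    (firstJust-cong (λ y → cong₂ (blockedAt y) (s≗s′ y) (s≗s′ (parent y))) (allFin m))

  outcome-rootMissing : ∀ s → outcome s ≡ rootMissing → s x ≡ nothing
  outcome-rootMissing s eq with s x | firstBlocked s
  outcome-rootMissing s eq  | nothing | _       = refl
  outcome-rootMissing s ()  | just _  | just _
  outcome-rootMissing s ()  | just _  | nothing

  outcome-blocked : ∀ s {β} → outcome s ≡ blocked β → firstBlocked s ≡ just β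
  outcome-blocked s eq with s x | firstBlocked s
  outcome-blocked s ()   | nothing | _
  outcome-blocked s refl | just _  | just _  = refl
  outcome-blocked s ()   | just _  | nothing

  outcome-complete : ∀ s → outcome s ≡ complete → (∃ λ c → s x ≡ just c) × firstBlocked s ≡ nothing
  outcome-complete s eq with s x | firstBlocked s
  outcome-complete s ()   | nothing | _
  outcome-complete s ()   | just _  | just _
  outcome-complete s refl | just c  | nothing = (c , refl) , refl

  firstBlocked-just : ∀ s {y y≢x c′} → firstBlocked s ≡ just (y , y≢x , c′) → s y ≡ nothing × s (parent y) ≡ just c′
  firstBlocked-just s found with z , at-z ← firstJust-just (allFin m) found = spec z at-z
    where
    spec : ∀ z {β} → blockedAt z (s z) (s (parent z)) ≡ just β →
           s (proj₁ β) ≡ nothing × s (parent (proj₁ β)) ≡ just (proj₂ (proj₂ β))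
    spec z at-z with s z in sz | s (parent z) in spz
    ... | nothing | just c′ with z ≟ᶠ x
    ...   | no _ with refl ← at-z = sz , spz

  firstBlocked-nothing : ∀ s → firstBlocked s ≡ nothing → ∀ {y} → y ≢ x → s y ≡ nothing → s (parent y) ≡ nothing
  firstBlocked-nothing s none {y} y≢x sy with firstJust-nothing none (∈-allFin y)
  ... | at-y rewrite sy with s (parent y)
  ... | nothing = refl
  ... | just c′ with y ≟ᶠ x
  ...   | yes y≡x = ⊥-elim (y≢x y≡x)

  complete⇒all-selected : ∀ s → outcome s ≡ complete → ∀ y → ∃ λ c → s y ≡ just c
  complete⇒all-selected s done with (c , sx) , none ← outcome-complete s done =
    parent-induction (λ y → ∃ λ c → s y ≡ just c) (c , sx) at-child
    where
    at-child : ∀ {y} → y ≢ x → ∃ (λ c′ → s (parent y) ≡ just c′) → ∃ λ c → s y ≡ just c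
    at-child {y} y≢x (c′ , spy) with s y in sy
    ... | just c = c , refl
    ... | nothing with () ← trans (sym spy) (firstBlocked-nothing s none y≢x sy)

  chosen : Selection → List (Subset n)
  chosen s = mapMaybe (λ y → Maybe.map (λ c → π (y , c)) (s y)) (allFin m)

  chosen-cong : ∀ {s s′ : Selection} → (∀ y → s y ≡ s′ y) → chosen s ≡ chosen s′
  chosen-cong s≗s′ = mapMaybe-cong (λ y → cong (Maybe.map _) (s≗s′ y)) (allFin m)

  chosen-length : ∀ s → length (chosen s) ≤ m
  chosen-length s = ≤-trans (length-mapMaybe _ (allFin m)) (≤-reflexive (length-tabulate id))

  chosen-∋ : ∀ s {y c} → s y ≡ just c → π (y , c) ∈ chosen s
  chosen-∋ s {y} {c} sy = Any.mapMaybe⁺ _ (allFin m) (Any.map⁺ (lose (∈-allFin y)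
    (subst (MaybeAny.Any (π (y , c) ≡_) ∘ Maybe.map (λ c → π (y , c))) (sym sy) (MaybeAny.just refl))))

  chosen-all : ∀ {Q : Subset n → Set} s → (∀ y {c} → s y ≡ just c → Q (π (y , c))) → All Q (chosen s)
  chosen-all s Q-selected = All.mapMaybe⁺ (All.map⁺ (All.tabulate⁺ at))
    where
    at : ∀ y → MaybeAll.All _ (Maybe.map (λ c → π (y , c)) (s y))
    at y with s y in sy
    ... | nothing = nothing
    ... | just c  = just (Q-selected y sy)

  blockCopy : ∀ {y} → y ≢ x → Copy (parent y) → Fin t → Copy y
  blockCopy {y} y≢x c′ i = cast (trans (*-comm _ t) (cong (t ^_) (sym (dist-parent y≢x)))) (combine c′ i)

  toℕ-blockCopy : ∀ {y} (y≢x : y ≢ x) c′ i → toℕ (blockCopy y≢x c′ i) ≡ t * toℕ c′ + toℕ i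
  toℕ-blockCopy y≢x c′ i = trans (toℕ-cast _ (combine c′ i)) (toℕ-combine c′ i)

  blockCopy-inBlock : ∀ {y} (y≢x : y ≢ x) c′ i → T (inBlock c′ (blockCopy y≢x c′ i))
  blockCopy-inBlock y≢x c′ i = fromWitness (sym (begin
    toℕ (blockCopy y≢x c′ i) / t  ≡⟨ cong (_/ t) (toℕ-blockCopy y≢x c′ i) ⟩
    (t * toℕ c′ + toℕ i) / t      ≡⟨ [n*q+r]/n≡q t (toℕ c′) (toℕ<n i) ⟩
    toℕ c′                        ∎))
    where open ≡-Reasoning

  blockCopy-injective : ∀ {y} (y≢x : y ≢ x) c′ {i j} → toℕ (blockCopy y≢x c′ i) ≡ toℕ (blockCopy y≢x c′ j) → i ≡ j
  blockCopy-injective y≢x c′ {i} {j} eq = toℕ-injective (+-cancelˡ-≡ (t * toℕ c′) _ _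
    (trans (sym (toℕ-blockCopy y≢x c′ i)) (trans eq (toℕ-blockCopy y≢x c′ j))))

  blockSets : Blocked → List (Subset n)
  blockSets (y , y≢x , c′) = tabulate (λ i → π (y , blockCopy y≢x c′ i))

  rootSet : Subset n
  rootSet = π (x , fromℕ< (m^n>0 t (dist P x x)))

  moveFor : Outcome → List (Subset n) → Maybe (Move n)
  moveFor rootMissing _    = just (rootSet ∷ [] , [])
  moveFor (blocked β) kept = just (blockSets β , kept)
  moveFor complete    _    = nothing

  move : Fam n → Maybe (Move n)
  move O = moveFor (outcome (select O)) (chosen (select O))

  module _ {O S : Fam n} (inS : ∀ a → T (S (π a))) (inj : ∀ a b → π a ≡ π b → a ≡ b) where

    move-spec : ∀ {L M} → move O ≡ just (L , M) → IsMove m t O S L M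
    move-spec = spec (outcome (select O)) refl
      where
      spec : ∀ o {L M} → outcome (select O) ≡ o → moveFor o (chosen (select O)) ≡ just (L , M) → IsMove m t O S L M
      spec rootMissing oc refl = record
        { removed-unique = [] ∷ []
        ; removed-in     = inS _ ∷ []
        ; removed-out    = select-root-missing O (outcome-rootMissing (select O) oc) _ ∷ []
        ; removed-some   = s≤s z≤n
        ; kept-in        = []
        ; kept-bound     = ≤-trans (≤-reflexive (*-zeroʳ t)) z≤n
        }
      spec (blocked (y , y≢x , c′)) oc refl
        with none , found′ ← firstBlocked-just (select O) (outcome-blocked (select O) oc) = record
        { removed-unique = Unique.tabulate⁺ λ eq → blockCopy-injective y≢x c′ (cong (toℕ ∘ proj₂) (inj _ _ eq))
        ; removed-in     = All.tabulate⁺ λ _ → inS _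
        ; removed-out    = All.tabulate⁺ λ i → select-blocked O y≢x found′ none _ (blockCopy-inBlock y≢x c′ i)
        ; removed-some   = subst (1 ≤_) (sym (length-tabulate _)) (ℕ.>-nonZero⁻¹ t)
        ; kept-in        = chosen-all (select O) λ y found → select-∈ O y found , inS _
        ; kept-bound     = begin
            t * length (chosen (select O))  ≤⟨ *-monoʳ-≤ t (chosen-length (select O)) ⟩
            t * m                           ≡⟨ *-comm t m ⟩
            m * t                           ≡⟨ cong (m *_) (length-tabulate _) ⟨
            m * length (blockSets (y , y≢x , c′)) ∎
        }
        where open ≤-Reasoning
      spec complete oc ()

    module _ (mono : ∀ a b → BGen P x t a b → π a ⊆ π b) where

      complete⇒copy : outcome (select O) ≡ complete → Contains O (Fin m) (_≤ₚ_ P)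
      complete⇒copy done = φ , (λ y → select-∈ O y (proj₂ (selected y))) , (λ eq → cong proj₁ (inj _ _ eq)) ,
                           λ a b a≤b → along (≼⇒covers⋆ a≤b)
        where
        open Covering P
        selected = complete⇒all-selected (select O) done
        β : Fin m → BElem P x t
        β y = y , proj₁ (selected y)
        φ : Fin m → Subset n
        φ = π ∘ β
        cover⇒bgen : ∀ {u w} → Covers u w → BGen P x t (β u) (β w)
        cover⇒bgen {u} {w} cov with adjacent⇒parent-edge (from T-∨ (inj₁ cov))
        ... | inj₁ (w≢x , refl) =
          up cov (dist-parent w≢x) (select-attached O w≢x (proj₂ (selected w)) (proj₂ (selected u)))
        ... | inj₂ (u≢x , refl) =
          down cov (dist-parent u≢x) (select-attached O u≢x (proj₂ (selected u)) (proj₂ (selected w)))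
        along : ∀ {a b} → Star Covers a b → φ a ⊆ φ b
        along ε                 = ⊆-refl
        along (cov ◅ covs) = ⊆-trans (mono _ _ (cover⇒bgen cov)) (along covs)

      move-nothing⇒copy : move O ≡ nothing → Contains O (Fin m) (_≤ₚ_ P)
      move-nothing⇒copy = spec (outcome (select O)) refl
        where
        spec : ∀ o → outcome (select O) ≡ o → moveFor o (chosen (select O)) ≡ nothing → Contains O (Fin m) (_≤ₚ_ P)
        spec complete done _ = complete⇒copy done

  move-agree : ∀ {H O} → H ⊆ᶠ O → (∀ y {c} → select O y ≡ just c → T (H (π (y , c)))) → move H ≡ move O
  move-agree H⊆O selected⇒H = cong₂ moveFor (outcome-cong agree) (chosen-cong agree)
    where agree = select-agree H⊆O selected⇒H

  selected⇒kept : ∀ {O L M} → move O ≡ just (L , M) → ∀ y {c} → select O y ≡ just c → π (y , c) ∈ M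
  selected⇒kept {O} = spec (outcome (select O)) refl
    where
    spec : ∀ o {L M} → outcome (select O) ≡ o → moveFor o (chosen (select O)) ≡ just (L , M) →
           ∀ y {c} → select O y ≡ just c → π (y , c) ∈ M
    spec rootMissing oc refl y found
      with () ← trans (sym found) (select-from-root O (outcome-rootMissing (select O) oc) y)
    spec (blocked _) _ refl y found = chosen-∋ (select O) found

-- The container algorithm

module Containers (P : FinPoset) (tree : IsTreePoset P) (x : Fin (size P)) (t : ℕ) .{{_ : NonZero t}} {n : ℕ} where

  open Blowup P x t

  private
    m = size P

  next : (O S : Fam n) → Maybe (Move n)
  next O S with containsBlowup? S
  ... | no _        = nothing
  ... | yes (π , _) = Greedy.move P tree x t π O

  next-move : ∀ {O S L M} → next O S ≡ just (L , M) → IsMove m t O S L M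
  next-move {O} {S} eq with containsBlowup? S
  ... | yes (π , inS , inj , mono) = Greedy.move-spec P tree x t π inS (λ _ _ → inj) eq

  next-halt : ∀ {O S} → PFree O P → next O S ≡ nothing → BlowupFree S P x t
  next-halt {O} {S} O-free none with containsBlowup? S
  ... | no S-free = S-free
  ... | yes (π , inS , inj , mono) =
    ⊥-elim (O-free (Greedy.move-nothing⇒copy P tree x t π {O} {S} inS (λ _ _ → inj) (λ a b g → mono a b (g ◅ ε))
                                                none))

  next-free : ∀ {O S} → BlowupFree S P x t → next O S ≡ nothing
  next-free {S = S} S-free with containsBlowup? S
  ... | no _      = refl
  ... | yes copy  = ⊥-elim (S-free copy)

  next-agree : ∀ {H O S L M} → H ⊆ᶠ O → next O S ≡ just (L , M) → All (T ∘ H) M → next H S ≡ just (L , M)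
  next-agree {H} {O} {S} H⊆O found kept⊆H with containsBlowup? S
  ... | yes (π , _) = trans (Greedy.move-agree P tree x t π H⊆O λ y sel →
                               All.lookup kept⊆H (Greedy.selected⇒kept P tree x t π found y sel)) found

  run : ℕ → (O S K : Fam n) → Fam n × Fam n
  run zero    O S K = K , S
  run (suc k) O S K = maybe′ (λ (L , M) → run k O (S ∖ L) (K ∪ᶠ listFam M)) (K , S) (next O S)

  module Step {O S K : Fam n} {L M} (mv : IsMove m t O S L M) where
    open IsMove mv

    remaining-⊆ : (S ∖ L) ⊆ᶠ S
    remaining-⊆ A = proj₁ ∘ to (T-∧ {S A})

    kept-⊆ : ∀ A → T (listFam M A) → T (O A) × T (S A)
    kept-⊆ A = All.lookup kept-in ∘ listFam⇒∈ M

    covered : O ⊆ᶠ (K ∪ᶠ S) → O ⊆ᶠ ((K ∪ᶠ listFam M) ∪ᶠ (S ∖ L))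
    covered O⊆K∪S A OA with ∪⁻ {F = K} {G = S} A (O⊆K∪S A OA)
    ... | inj₁ KA = ∪⁺ˡ {F = K ∪ᶠ listFam M} {G = S ∖ L} A (∪⁺ˡ {F = K} {G = listFam M} A KA)
    ... | inj₂ SA = ∪⁺ʳ {F = K ∪ᶠ listFam M} {G = S ∖ L} A
                        (from T-∧ (SA , T-not⁺ λ inL → All.lookup removed-out (listFam⇒∈ L inL) OA))

    shrinks : card (S ∖ L) < card S
    shrinks = begin-strict
      card (S ∖ L)             <⟨ m<m+n (card (S ∖ L)) removed-some ⟩
      card (S ∖ L) + length L  ≤⟨ card-∖ removed-unique removed-in ⟩
      card S                   ∎
      where open ≤-Reasoning

    bounded : t * card (K ∪ᶠ listFam M) + m * card (S ∖ L) ≤ t * card K + m * card S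
    bounded = begin
      t * card (K ∪ᶠ listFam M) + m * card (S ∖ L)    ≤⟨ +-monoˡ-≤ _ (*-monoʳ-≤ t K′≤K+M) ⟩
      t * (card K + length M) + m * card (S ∖ L)      ≡⟨ cong (_+ m * card (S ∖ L)) (*-distribˡ-+ t (card K) (length M)) ⟩
      t * card K + t * length M + m * card (S ∖ L)    ≤⟨ +-monoˡ-≤ _ (+-monoʳ-≤ (t * card K) kept-bound) ⟩
      t * card K + m * length L + m * card (S ∖ L)    ≡⟨ +-assoc (t * card K) _ _ ⟩
      t * card K + (m * length L + m * card (S ∖ L))  ≡⟨ cong (t * card K +_) regroup ⟩
      t * card K + m * (card (S ∖ L) + length L)      ≤⟨ +-monoʳ-≤ (t * card K) (*-monoʳ-≤ m (card-∖ removed-unique removed-in)) ⟩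
      t * card K + m * card S                         ∎
      where
      open ≤-Reasoning
      K′≤K+M : card (K ∪ᶠ listFam M) ≤ card K + length M
      K′≤K+M = ≤-trans (card-∪ K (listFam M)) (+-monoʳ-≤ (card K) (card-listFam M))
      regroup : m * length L + m * card (S ∖ L) ≡ m * (card (S ∖ L) + length L)
      regroup = trans (+-comm (m * length L) _) (sym (*-distribˡ-+ m (card (S ∖ L)) (length L)))

  module _ {O : Fam n} where

    run-grows : ∀ k {S K} → K ⊆ᶠ proj₁ (run k O S K)
    run-grows zero            _ h = h
    run-grows (suc k) {S} {K} with next O S
    ... | nothing      = λ _ h → h
    ... | just (L , M) = λ A h → run-grows k A (∪⁺ˡ {F = K} {G = listFam M} A h)

    run-kept-⊆ : ∀ k {S K} → proj₁ (run k O S K) ⊆ᶠ (K ∪ᶠ S)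
    run-kept-⊆ zero {S} {K}    A h = ∪⁺ˡ {F = K} {G = S} A h
    run-kept-⊆ (suc k) {S} {K} with next O S in found
    ... | nothing      = λ A h → ∪⁺ˡ {F = K} {G = S} A h
    ... | just (L , M) = λ A h → shrink A (run-kept-⊆ k A h)
      where
      shrink : ((K ∪ᶠ listFam M) ∪ᶠ (S ∖ L)) ⊆ᶠ (K ∪ᶠ S)
      shrink A h with ∪⁻ {F = K ∪ᶠ listFam M} {G = S ∖ L} A h
      ... | inj₂ S′A = ∪⁺ʳ {F = K} {G = S} A (Step.remaining-⊆ {K = K} (next-move found) A S′A)
      ... | inj₁ K′A with ∪⁻ {F = K} {G = listFam M} A K′A
      ...   | inj₁ KA = ∪⁺ˡ {F = K} {G = S} A KA
      ...   | inj₂ MA = ∪⁺ʳ {F = K} {G = S} A (proj₂ (Step.kept-⊆ {K = K} (next-move found) A MA))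

    run-remaining-⊆ : ∀ k {S K} → proj₂ (run k O S K) ⊆ᶠ S
    run-remaining-⊆ zero            _ h = h
    run-remaining-⊆ (suc k) {S} {K} with next O S in found
    ... | nothing      = λ _ h → h
    ... | just (L , M) = λ A h → Step.remaining-⊆ {K = K} (next-move found) A (run-remaining-⊆ k A h)

    run-kept-in-oracle : ∀ k {S K} → K ⊆ᶠ O → proj₁ (run k O S K) ⊆ᶠ O
    run-kept-in-oracle zero            K⊆O = K⊆O
    run-kept-in-oracle (suc k) {S} {K} K⊆O with next O S in found
    ... | nothing      = K⊆O
    ... | just (L , M) = run-kept-in-oracle k K′⊆O
      where
      K′⊆O : (K ∪ᶠ listFam M) ⊆ᶠ O
      K′⊆O A h with ∪⁻ {F = K} {G = listFam M} A h
      ... | inj₁ KA = K⊆O A KA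
      ... | inj₂ MA = proj₁ (Step.kept-⊆ {K = K} (next-move found) A MA)

    run-covers : ∀ k {S K} → O ⊆ᶠ (K ∪ᶠ S) → O ⊆ᶠ (proj₁ (run k O S K) ∪ᶠ proj₂ (run k O S K))
    run-covers zero            O⊆ = O⊆
    run-covers (suc k) {S} {K} O⊆ with next O S in found
    ... | nothing      = O⊆
    ... | just (L , M) = run-covers k (Step.covered {K = K} (next-move found) O⊆)

    run-bound : ∀ k {S K} → t * card (proj₁ (run k O S K)) ≤ t * card K + m * card S
    run-bound zero            = m≤m+n _ _
    run-bound (suc k) {S} {K} with next O S in found
    ... | nothing      = m≤m+n _ _
    ... | just (L , M) = ≤-trans (run-bound k) (Step.bounded {K = K} (next-move found))

    run-free : ∀ k {S K} → PFree O P → card S < k → BlowupFree (proj₂ (run k O S K)) P x t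
    run-free (suc k) {S} {K} O-free S<k with next O S in found
    ... | nothing      = next-halt O-free found
    ... | just (L , M) = run-free k O-free (≤-trans (Step.shrinks {K = K} (next-move found)) (≤-pred S<k))

  run-agree : ∀ k {H O S K} → H ⊆ᶠ O → PFree O P → proj₁ (run k O S K) ⊆ᶠ H → run k H S K ≡ run k O S K
  run-agree zero    _ _ _ = refl
  run-agree (suc k) {H} {O} {S} {K} H⊆O O-free kept⊆H with next O S in found
  ... | nothing      = cong (maybe′ _ (K , S)) (next-free (next-halt O-free found))
  ... | just (L , M) = trans (cong (maybe′ _ (K , S)) (next-agree H⊆O found M⊆H)) (run-agree k H⊆O O-free kept⊆H)
    where
    M⊆H : All (T ∘ H) M
    M⊆H = All.tabulate λ A∈M → kept⊆H _ (run-grows {O} k _ (∪⁺ʳ {F = K} {G = listFam M} _ (∈⇒listFam A∈M)))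

  module _ (S : Fam n) where

    -- Every move deletes a set from S, so card S + 1 rounds end with a P(x,t)-free family.
    fuel : ℕ
    fuel = suc (card S)

    container : Fam n → Fam n × Fam n
    container O = run fuel O S ∅

    IsContainer : Fam n → Fam n → Set
    IsContainer H G = PFree H P × (proj₁ (container H) ≐ H) × (proj₂ (container H) ≐ G)

    container-⊆ : ∀ {H G} → IsContainer H G → (H ⊆ᶠ S) × (G ⊆ᶠ S)
    container-⊆ {H} (_ , kept , rest) =
      (λ A → run-kept-⊆ {H} fuel {S} {∅} A ∘ ≐⇒⊆ (sym ∘ kept) A) ,
      (λ A → run-remaining-⊆ {H} fuel {S} {∅} A ∘ ≐⇒⊆ (sym ∘ rest) A)

    container-exists : ∀ F → F ⊆ᶠ S → PFree F P → ∃₂ λ H G → IsContainer H G × (H ⊆ᶠ F) × (F ⊆ᶠ (H ∪ᶠ G))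
    container-exists F F⊆S F-free =
      H , G , (F-free ∘ Contains-mono H⊆F , ≡⇒≐ (cong proj₁ same) , ≡⇒≐ (cong proj₂ same)) ,
      H⊆F , run-covers fuel {S} {∅} F⊆S
      where
      H = proj₁ (container F)
      G = proj₂ (container F)
      H⊆F : H ⊆ᶠ F
      H⊆F = run-kept-in-oracle fuel {S} {∅} (λ _ ())
      same : container H ≡ container F
      same = run-agree fuel H⊆F F-free (λ _ h → h)

    container-free : ∀ {H G} → IsContainer H G → BlowupFree G P x t
    container-free (H-free , _ , rest) = run-free fuel {S} {∅} H-free ≤-refl ∘ Contains-mono (≐⇒⊆ (sym ∘ rest))

    container-small : ∀ {H G} → IsContainer H G → t * card H ≤ m * card S
    container-small {H} (_ , kept , _) = begin
      t * card H                         ≤⟨ *-monoʳ-≤ t (card-mono (≐⇒⊆ (sym ∘ kept))) ⟩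
      t * card (proj₁ (container H))     ≤⟨ run-bound {H} fuel {S} {∅} ⟩
      t * card (∅ {n}) + m * card S      ≡⟨ cong (λ c → t * c + m * card S) (card-∅ {n}) ⟩
      t * 0 + m * card S                 ≡⟨ cong (_+ m * card S) (*-zeroʳ t) ⟩
      m * card S                         ∎
      where open ≤-Reasoning

    container-unique : ∀ {H G H′ G′} → IsContainer H G → IsContainer H′ G′ → H ≐ H′ → G ≐ G′
    container-unique {H} {G} {H′} {G′} (_ , _ , rest) (H′-free , kept′ , rest′) H≐H′ A = begin
      G A                     ≡⟨ rest A ⟨
      proj₂ (container H) A   ≡⟨ cong (λ c → proj₂ c A) same ⟩
      proj₂ (container H′) A  ≡⟨ rest′ A ⟩
      G′ A                    ∎
      where
      open ≡-Reasoning
      same : container H ≡ container H′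
      same = run-agree fuel (≐⇒⊆ H≐H′) H′-free λ B → ≐⇒⊆ (sym ∘ H≐H′) B ∘ ≐⇒⊆ kept′ B

lemma2p13 : (P : FinPoset) → IsTreePoset P → (x : Fin (size P)) →
    (t : ℕ) → .{{_ : NonZero t}} → (n : ℕ) → (S : Fam n) →
    Σ (Fam n → Fam n → Set) λ C →
      (∀ H G → C H G → (H ⊆ᶠ S) × (G ⊆ᶠ S)) ×
      (∀ F → F ⊆ᶠ S → PFree F P →
        ∃₂ λ H G → C H G × (H ⊆ᶠ F) × (F ⊆ᶠ (H ∪ᶠ G))) ×
      (∀ H G → C H G → BlowupFree G P x t × (t * card H ≤ size P * card S)) ×
      (∀ H G H′ G′ → C H G → C H′ G′ → H ≐ H′ → G ≐ G′)
lemma2p13 P tree x t n S =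
  IsContainer S ,
  (λ _ _ → container-⊆ S) ,
  container-exists S ,
  (λ _ _ is-container → container-free S is-container , container-small S is-container) ,
  (λ _ _ _ _ → container-unique S)
  where
  open Containers P tree x t {n}
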